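{- Let $B$ be a lower Eulerian poset with a weak rank function $r_B$ (not necessarily equal to its natural weak rank function $\rho_B$). Suppose $\kappa_B$ is a rank alternating $B$-kernel, with right and left Kazhdan–Lusztig–Stanley functions $f_B,g_B$. Then $\widehat{f_B}=g_B^{ -1}$ and $\widehat{g_B}=f_B^{ -1}$.
   Context: $B$ is finite. $I(B)$ is the set of functions $p$ from closed intervals $[z,z']$ of $B$ to $\mathbb{Z}[t]$, a ring under pointwise sum and product $(p\cdot p')(z,z')=\sum_{z\le z''\le z'}p(z,z'')p'(z'',z')$. A weak rank function is $r_B\in I(B)$ with nonnegative integer values, positive for $z<z'$, with $r_B(z,z')=r_B(z,z'')+r_B(z'',z')$. $\mathcal{I}(B)=\{p:\deg p(z,z')\le r_B(z,z')\}$, with involution $p^{\mathrm{rev}}(z,z';t)=t^{r_B(z,z')}p(z,z';t^{ -1})$; $\mathcal{I}_{1/2}(B)=\{p\in\mathcal{I}(B):\deg p(z,z')<r_B(z,z')/2$ for $z<z'\}$; $U(B)=\{p:p(z,z)=1\}$. A $B$-kernel is $\kappa\in\mathcal{I}(B)\cap U(B)$ with $\kappa^{ -1}=\kappa^{\mathrm{rev}}$; $f_B,g_B$ are the unique elements of $\mathcal{I}_{1/2}(B)\cap U(B)$ with $f_B^{\mathrm{rev}}=\kappa_B\cdot f_B$ and $g_B^{\mathrm{rev}}=g_B\cdot\kappa_B$. $B$ lower Eulerian: unique minimal element, rank function $\rho_B$ ($\rho_B(z')=\rho_B(z)+1$ when $z'$ covers $z$), and $\sum_{z\le z''\le z'}(-1)^{\rho_B(z'')}=0$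 for $z<z'$; $\rho_B(z,z')=\rho_B(z')-\rho_B(z)$. $\widehat p(z,z')=(-1)^{\rho_B(z,z')}p(z,z')$; $p$ is rank alternating if $p^{\mathrm{rev}}=\widehat p$. -}

module Defs where

open import Level using (0ℓ)
open import Data.Nat as ℕ using (ℕ; zero; suc; _∸_)
open import Data.Integer as ℤ using (ℤ; 0ℤ; 1ℤ; -_)
open import Data.Fin using (Fin)
open import Data.Product using (Σ; _×_; ∃)
open import Relation.Nullary using (¬_; yes; no)
open import Relation.Binary using (IsDecPartialOrder)
open import Relation.Binary.PropositionalEquality using (_≡_)

record FinPoset : Set₁ where
  field
    size  : ℕ
    _≤_   : Fin size → Fin size → Set
    isDPO : IsDecPartialOrder _≡_ _≤_
  open IsDecPartialOrder isDPO public using (_≤?_)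

  Elt : Set
  Elt = Fin size

  _<_ : Elt → Elt → Set
  z < z' = z ≤ z' × ¬ (z ≡ z')

-- Polynomials in ℤ[t] as coefficient sequences ℕ → ℤ.
-- (Every element appearing in the statement has bounded degree, imposed
-- explicitly as a hypothesis.)

Poly : Set
Poly = ℕ → ℤ

sumTo : ℕ → (ℕ → ℤ) → ℤ
sumTo zero    a = a 0
sumTo (suc k) a = a (suc k) ℤ.+ sumTo k a

_*ₚ_ : Poly → Poly → Poly
(a *ₚ b) k = sumTo k (λ i → a i ℤ.* b (k ∸ i))

oneₚ : Poly
oneₚ zero    = 1ℤ
oneₚ (suc _) = 0ℤ

zeroₚ : Poly
zeroₚ _ = 0ℤ

sumFin : ∀ {m} → (Fin m → ℤ) → ℤ
sumFin {zero}  f = 0ℤ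
sumFin {suc m} f = f Fin.zero ℤ.+ sumFin {m} (λ i → f (Fin.suc i))

module _ (B : FinPoset) where
  open FinPoset B

  -- An element of I(B); only values on intervals z ≤ z' matter.
  Inc : Set
  Inc = Elt → Elt → Poly

  _≈ᴵ_ : Inc → Inc → Set
  p ≈ᴵ q = ∀ z z' → z ≤ z' → ∀ k → p z z' k ≡ q z z' k

  _·ᴵ_ : Inc → Inc → Inc
  (p ·ᴵ q) z z' k = sumFin (λ w → term w (z ≤? w) (w ≤? z'))
    where
    open import Relation.Nullary using (Dec)
    term : (w : Elt) → Dec (z ≤ w) → Dec (w ≤ z') → ℤ
    term w (yes _) (yes _) = (p z w *ₚ q w z') k
    term w _       _       = 0ℤ

  δᴵ : Inc
  δᴵ z z' with z Data.Fin.≟ z'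
  ... | yes _ = oneₚ
  ... | no  _ = zeroₚ

  IsInverse : Inc → Inc → Set
  IsInverse p q = ((p ·ᴵ q) ≈ᴵ δᴵ) × ((q ·ᴵ p) ≈ᴵ δᴵ)

  IsWeakRank : (Elt → Elt → ℕ) → Set
  IsWeakRank r =
    (∀ z z' → z < z' → 0 ℕ.< r z z') ×
    (∀ z z'' z' → z ≤ z'' → z'' ≤ z' → r z z' ≡ r z z'' ℕ.+ r z'' z')

  module _ (r : Elt → Elt → ℕ) where

    InCalI : Inc → Set
    InCalI p = ∀ z z' → z ≤ z' → ∀ k → r z z' ℕ.< k → p z z' k ≡ 0ℤ

    -- deg p(z,z') < r(z,z')/2 for z < z', i.e. coefficient k vanishes
    -- whenever r(z,z') ≤ 2k   (together with p ∈ 𝓘(B): p ∈ 𝓘_{1/2}(B))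
    InCalIHalf : Inc → Set
    InCalIHalf p = InCalI p ×
      (∀ z z' → z < z' → ∀ k → r z z' ℕ.≤ 2 ℕ.* k → p z z' k ≡ 0ℤ)

    InU : Inc → Set
    InU p = ∀ z k → p z z k ≡ oneₚ k

    -- p^rev(z,z';t) = t^{r(z,z')} p(z,z';t⁻¹)
    rev : Inc → Inc
    rev p z z' k with k ℕ.≤? r z z'
    ... | yes _ = p z z' (r z z' ∸ k)
    ... | no  _ = 0ℤ

    IsKernel : Inc → Set
    IsKernel κ = InCalI κ × InU κ × IsInverse κ (rev κ)

    IsRightKLS : Inc → Inc → Set
    IsRightKLS κ f = InCalIHalf f × InU f × (rev f ≈ᴵ (κ ·ᴵ f))

    IsLeftKLS : Inc → Inc → Set
    IsLeftKLS κ g = InCalIHalf g × InU g × (rev g ≈ᴵ (g ·ᴵ κ))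

  Minimal : Elt → Set
  Minimal m = ∀ z → z ≤ m → z ≡ m

  _⋖_ : Elt → Elt → Set
  z ⋖ z' = z < z' × (∀ w → z < w → ¬ (w < z'))

  IsRank : (Elt → ℕ) → Set
  IsRank ρ = ∀ z z' → z ⋖ z' → ρ z' ≡ suc (ρ z)

  sign : ℕ → ℤ
  sign zero          = 1ℤ
  sign (suc zero)    = - 1ℤ
  sign (suc (suc m)) = sign m

  altSum : (Elt → ℕ) → Elt → Elt → ℤ
  altSum ρ z z' = sumFin (λ w → term w (z ≤? w) (w ≤? z'))
    where
    open import Relation.Nullary using (Dec)
    term : (w : Elt) → Dec (z ≤ w) → Dec (w ≤ z') → ℤ
    term w (yes _) (yes _) = sign (ρ w)
    term w _       _       = 0ℤ

  IsLowerEulerian : (Elt → ℕ) → Set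
  IsLowerEulerian ρ =
    (Σ Elt λ m → Minimal m × (∀ m' → Minimal m' → m' ≡ m)) ×
    IsRank ρ ×
    (∀ z z' → z < z' → altSum ρ z z' ≡ 0ℤ)

  hat : (Elt → ℕ) → Inc → Inc
  hat ρ p z z' k = sign (ρ z' ∸ ρ z) ℤ.* p z z' k

  IsRankAlternating : (Elt → Elt → ℕ) → (Elt → ℕ) → Inc → Set
  IsRankAlternating r ρ p = rev r p ≈ᴵ hat ρ p

-- Reversal p ↦ p^rev and the sign twist p ↦ p̂ are both multiplicative on 𝓘(B), by additivity
-- of r and monotonicity of ρ respectively, and they commute.  With the KLS equations and rank
-- alternation this gives rev(g·f̂) = (g·κ)·(κ̂·f̂) = g·(κ·κ^rev)·f̂ = g·f̂.  But g·f̂ is unipotent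
-- with all off-diagonal degrees below r/2, and the only self-reversed such element is δ; hence
-- g·f̂ = δ.  Then f̂·g is a unipotent idempotent, so it is δ as well, and the involutive
-- automorphism p ↦ p̂ turns f̂·g = g·f̂ = δ into ĝ·f = f·ĝ = δ.

module Submission where

open import Defs
open import Algebra.Bundles using (AbelianGroup)
import Algebra.Properties.Group as GroupProperties
open import Data.Empty using (⊥-elim)
open import Data.Fin as Fin using (Fin; toℕ; punchIn; _≟_)
open import Data.Fin.Induction using (po-wellFounded; po-noetherian)
open import Data.Fin.Permutation using (reverse)
open import Data.Fin.Properties using (punchInᵢ≢i; opposite-prop; any?)
open import Data.Integer using (ℤ; 0ℤ; 1ℤ; -_; _+_; _*_)
import Data.Integer.Properties as ℤP
open import Data.Integer.Tactic.RingSolver using (solve-∀)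
open import Data.Nat as ℕ using (ℕ; zero; suc; _∸_; z≤n; s≤s)
import Data.Nat.Properties as ℕP
open import Data.Nat.Tactic.RingSolver using () renaming (solve-∀ to ℕsolve-∀)
open import Data.Product using (Σ; _×_; _,_; proj₁; proj₂)
open import Data.Sum using (_⊎_; inj₁; inj₂)
open import Function using (_∘_; flip)
open import Induction.WellFounded using (WellFounded; Acc; acc)
open import Level using (0ℓ)
open import Relation.Binary using (Setoid; IsDecPartialOrder)
import Relation.Binary.Reasoning.Setoid as SetoidReasoning
open import Relation.Binary.PropositionalEquality
open import Relation.Nullary using (¬_; ¬?; Dec; yes; no; _×-dec_)

open import Algebra.Properties.Semiring.Sum ℤP.+-*-semiring
  using (sum; sum-syntax; sum-cong-≗; sum-remove; sum-permute; sum-replicate-zero;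
         ∑-distrib-+; ∑-comm; *-distribʳ-sum; *-distribˡ-sum)

x≡x+x⇒x≡0 : ∀ {x : ℤ} → x ≡ x + x → x ≡ 0ℤ
x≡x+x⇒x≡0 {x} x≡x+x = sym (∙-cancelˡ x 0ℤ x (trans (ℤP.+-identityʳ x) x≡x+x))
  where open GroupProperties (AbelianGroup.group ℤP.+-0-abelianGroup) using (∙-cancelˡ)

∸-+-∸ : ∀ {i m j n} → i ℕ.≤ m → j ℕ.≤ n → (m ∸ i) ℕ.+ (n ∸ j) ≡ (m ℕ.+ n) ∸ (i ℕ.+ j)
∸-+-∸ {i} {m} {j} {n} i≤m j≤n = begin
  (m ∸ i) ℕ.+ (n ∸ j)   ≡⟨ ℕP.+-∸-assoc (m ∸ i) j≤n ⟨
  (m ∸ i) ℕ.+ n ∸ j     ≡⟨ cong (_∸ j) (ℕP.+-∸-comm n i≤m) ⟨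
  (m ℕ.+ n) ∸ i ∸ j     ≡⟨ ℕP.∸-+-assoc (m ℕ.+ n) i j ⟩
  (m ℕ.+ n) ∸ (i ℕ.+ j) ∎
  where open ≡-Reasoning

∸-split : ∀ {a b c} → a ℕ.≤ b → b ℕ.≤ c → c ∸ a ≡ (b ∸ a) ℕ.+ (c ∸ b)
∸-split {a} {b} {c} a≤b b≤c = begin
  c ∸ a                 ≡⟨ cong (_∸ a) (ℕP.m∸n+n≡m b≤c) ⟨
  (c ∸ b) ℕ.+ b ∸ a     ≡⟨ ℕP.+-∸-assoc (c ∸ b) a≤b ⟩
  (c ∸ b) ℕ.+ (b ∸ a)   ≡⟨ ℕP.+-comm (c ∸ b) (b ∸ a) ⟩
  (b ∸ a) ℕ.+ (c ∸ b)   ∎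
  where open ≡-Reasoning

half-split : ∀ {a b i j} → a ℕ.+ b ℕ.≤ 2 ℕ.* (i ℕ.+ j) → 0 ℕ.< a ℕ.+ b ℕ.+ (i ℕ.+ j) →
             (a ℕ.≤ 2 ℕ.* i × 0 ℕ.< a ℕ.+ i) ⊎ (b ℕ.≤ 2 ℕ.* j × 0 ℕ.< b ℕ.+ j)
half-split {a} {b} {i} {j} a+b≤2[i+j] pos with a ℕ.≤? 2 ℕ.* i | 0 ℕ.<? a ℕ.+ i
... | yes a≤2i | yes 0<a+i = inj₁ (a≤2i , 0<a+i)
... | yes _    | no  0≮a+i
  rewrite ℕP.m+n≡0⇒m≡0 a (ℕP.n≤0⇒n≡0 (ℕP.≮⇒≥ 0≮a+i))
        | ℕP.m+n≡0⇒n≡0 a {i} (ℕP.n≤0⇒n≡0 (ℕP.≮⇒≥ 0≮a+i)) = inj₂ (a+b≤2[i+j] , pos)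
... | no  a≰2i | _ = inj₂ (ℕP.<⇒≤ b<2j , ℕP.<-≤-trans (0<2j⇒0<j b<2j) (ℕP.m≤n+m j b))
  where
  b<2j : b ℕ.< 2 ℕ.* j
  b<2j = ℕP.+-cancelˡ-≤ (2 ℕ.* i) _ _ (begin
    2 ℕ.* i ℕ.+ suc b     ≡⟨ ℕP.+-suc (2 ℕ.* i) b ⟩
    suc (2 ℕ.* i) ℕ.+ b   ≤⟨ ℕP.+-monoˡ-≤ b (ℕP.≰⇒> a≰2i) ⟩
    a ℕ.+ b               ≤⟨ a+b≤2[i+j] ⟩
    2 ℕ.* (i ℕ.+ j)       ≡⟨ ℕP.*-distribˡ-+ 2 i j ⟩
    2 ℕ.* i ℕ.+ 2 ℕ.* j   ∎)
    where open ℕP.≤-Reasoning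
  0<2j⇒0<j : ∀ {j} → b ℕ.< 2 ℕ.* j → 0 ℕ.< j
  0<2j⇒0<j {suc _} _ = ℕP.0<1+n

m≰2n⇒m≤2[m∸n] : ∀ m n → ¬ (m ℕ.≤ 2 ℕ.* n) → m ℕ.≤ 2 ℕ.* (m ∸ n)
m≰2n⇒m≤2[m∸n] m n m≰2n with ℕP.m≤n⇒∃[o]m+o≡n (ℕP.<⇒≤ (ℕP.≰⇒> m≰2n))
... | d , refl = begin
  2 ℕ.* n ℕ.+ d             ≤⟨ ℕP.m≤m+n (2 ℕ.* n ℕ.+ d) d ⟩
  2 ℕ.* n ℕ.+ d ℕ.+ d       ≡⟨ double n d ⟩
  2 ℕ.* (n ℕ.+ d)           ≡⟨ cong (2 ℕ.*_) (ℕP.m+n∸m≡n n (n ℕ.+ d)) ⟨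
  2 ℕ.* (n ℕ.+ (n ℕ.+ d) ∸ n) ≡⟨ cong (λ x → 2 ℕ.* (x ∸ n)) (split n d) ⟩
  2 ℕ.* (2 ℕ.* n ℕ.+ d ∸ n) ∎
  where
  open ℕP.≤-Reasoning
  double : ∀ n d → 2 ℕ.* n ℕ.+ d ℕ.+ d ≡ 2 ℕ.* (n ℕ.+ d)
  double = ℕsolve-∀
  split : ∀ n d → n ℕ.+ (n ℕ.+ d) ≡ 2 ℕ.* n ℕ.+ d
  split = ℕsolve-∀

𝟙 : {P : Set} → Dec P → ℤ → ℤ
𝟙 (yes _) x = x
𝟙 (no _)  _ = 0ℤ

private variable
  P Q : Set
  x y : ℤ

𝟙-yes : (d : Dec P) → P → 𝟙 d x ≡ x
𝟙-yes (yes _) _ = refl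
𝟙-yes (no ¬p) p = ⊥-elim (¬p p)

𝟙-no : (d : Dec P) → ¬ P → 𝟙 d x ≡ 0ℤ
𝟙-no (yes p) ¬p = ⊥-elim (¬p p)
𝟙-no (no _)  _  = refl

𝟙-cong : (d : Dec P) → (P → x ≡ y) → 𝟙 d x ≡ 𝟙 d y
𝟙-cong (yes p) eq = eq p
𝟙-cong (no _)  _  = refl

𝟙-zero : (d : Dec P) → (P → x ≡ 0ℤ) → 𝟙 d x ≡ 0ℤ
𝟙-zero (yes p) eq = eq p
𝟙-zero (no _)  _  = refl

𝟙-⇔ : (d : Dec P) (e : Dec Q) → (P → Q) → (Q → P) → 𝟙 d x ≡ 𝟙 e x
𝟙-⇔ (yes p) e to _    = sym (𝟙-yes e (to p))
𝟙-⇔ (no ¬p) e _  from = sym (𝟙-no e (¬p ∘ from))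

𝟙-𝟙 : (d : Dec P) (e : Dec Q) → 𝟙 d (𝟙 e x) ≡ 𝟙 (d ×-dec e) x
𝟙-𝟙 (yes _) (yes _) = refl
𝟙-𝟙 (yes _) (no _)  = refl
𝟙-𝟙 (no _)  _       = refl

𝟙-swap : (d : Dec P) (e : Dec Q) → 𝟙 d (𝟙 e x) ≡ 𝟙 e (𝟙 d x)
𝟙-swap (yes _) (yes _) = refl
𝟙-swap (yes _) (no _)  = refl
𝟙-swap (no _)  (yes _) = refl
𝟙-swap (no _)  (no _)  = refl

𝟙-*ˡ : (d : Dec P) → ∀ c → c * 𝟙 d x ≡ 𝟙 d (c * x)
𝟙-*ˡ (yes _) c = refl
𝟙-*ˡ (no _)  c = ℤP.*-zeroʳ c

𝟙-*ʳ : (d : Dec P) → ∀ c → 𝟙 d x * c ≡ 𝟙 d (x * c)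
𝟙-*ʳ (yes _) c = refl
𝟙-*ʳ (no _)  c = refl

𝟙-𝟙-⇔ : ∀ {R} (d : Dec P) (e : Dec Q) (f : Dec R) →
         (P × Q → R) → (R → P × Q) → (P × Q → x ≡ y) → 𝟙 d (𝟙 e x) ≡ 𝟙 f y
𝟙-𝟙-⇔ d e f to from eq =
  trans (𝟙-𝟙 d e) (trans (𝟙-cong (d ×-dec e) eq) (𝟙-⇔ (d ×-dec e) f to from))

sumFin≗sum : ∀ {n} {f g : Fin n → ℤ} → (∀ w → f w ≡ g w) → sumFin f ≡ sum g
sumFin≗sum {zero}  _   = refl
sumFin≗sum {suc n} f≗g = cong₂ _+_ (f≗g Fin.zero) (sumFin≗sum (f≗g ∘ Fin.suc))

sum-𝟙 : ∀ {n P} (d : Dec P) (f : Fin n → ℤ) → sum (λ w → 𝟙 d (f w)) ≡ 𝟙 d (sum f)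
sum-𝟙 {n} (yes _) f = refl
sum-𝟙 {n} (no _)  f = sum-replicate-zero n

sum-single : ∀ {n} (t : Fin (suc n)) {f : Fin (suc n) → ℤ} →
             (∀ w → w ≢ t → f w ≡ 0ℤ) → sum f ≡ f t
sum-single {n} t {f} vanish = begin
  sum f                             ≡⟨ sum-remove {i = t} f ⟩
  f t + ∑[ j < n ] f (punchIn t j)  ≡⟨ cong (f t +_) (sum-cong-≗ {n} {x = λ j → f (punchIn t j)}
                                                         (λ j → vanish _ (punchInᵢ≢i t j))) ⟩
  f t + ∑[ _ < n ] 0ℤ                ≡⟨ cong (f t +_) (sum-replicate-zero n) ⟩
  f t + 0ℤ                          ≡⟨ ℤP.+-identityʳ (f t) ⟩
  f t                               ∎
  where open ≡-Reasoning

sum-δ : ∀ {n} (t : Fin n) (x : ℤ) → sum (λ w → 𝟙 (w ≟ t) x) ≡ x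
sum-δ {suc n} t x = trans (sum-single t (λ w w≢t → 𝟙-no (w ≟ t) w≢t)) (𝟙-yes (t ≟ t) refl)

sumTo≡sum : ∀ k (F : ℕ → ℤ) → sumTo k F ≡ ∑[ i < suc k ] F (k ∸ toℕ i)
sumTo≡sum zero    F = sym (ℤP.+-identityʳ (F 0))
sumTo≡sum (suc k) F = cong (F (suc k) +_) (sumTo≡sum k F)

module _ (k : ℕ) where

  sumTo-cong : ∀ {F G : ℕ → ℤ} → (∀ i → i ℕ.≤ k → F i ≡ G i) → sumTo k F ≡ sumTo k G
  sumTo-cong {F} {G} eq = begin
    sumTo k F                      ≡⟨ sumTo≡sum k F ⟩
    ∑[ i < suc k ] F (k ∸ toℕ i)   ≡⟨ sum-cong-≗ {suc k} (λ i → eq (k ∸ toℕ i) (ℕP.m∸n≤m k (toℕ i))) ⟩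
    ∑[ i < suc k ] G (k ∸ toℕ i)   ≡⟨ sumTo≡sum k G ⟨
    sumTo k G                      ∎
    where open ≡-Reasoning

  sumTo-zero : ∀ {F : ℕ → ℤ} → (∀ i → i ℕ.≤ k → F i ≡ 0ℤ) → sumTo k F ≡ 0ℤ
  sumTo-zero eq = trans (sumTo-cong eq) (trans (sumTo≡sum k (λ _ → 0ℤ)) (sum-replicate-zero (suc k)))

  sumTo-*ˡ : ∀ c (F : ℕ → ℤ) → c * sumTo k F ≡ sumTo k (λ i → c * F i)
  sumTo-*ˡ c F = trans (cong (c *_) (sumTo≡sum k F))
                       (trans (*-distribˡ-sum {suc k} c (λ i → F (k ∸ toℕ i)))
                              (sym (sumTo≡sum k (λ i → c * F i))))

  sumTo-*ʳ : ∀ c (F : ℕ → ℤ) → sumTo k F * c ≡ sumTo k (λ i → F i * c)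
  sumTo-*ʳ c F = trans (cong (_* c) (sumTo≡sum k F))
                       (trans (*-distribʳ-sum {suc k} c (λ i → F (k ∸ toℕ i)))
                              (sym (sumTo≡sum k (λ i → F i * c))))

  sumTo-𝟙 : ∀ {P} (d : Dec P) (F : ℕ → ℤ) → sumTo k (λ i → 𝟙 d (F i)) ≡ 𝟙 d (sumTo k F)
  sumTo-𝟙 (yes _) F = refl
  sumTo-𝟙 (no _)  F = sumTo-zero (λ _ _ → refl)

  sumTo-comm : ∀ l (F : ℕ → ℕ → ℤ) →
               sumTo k (λ i → sumTo l (F i)) ≡ sumTo l (λ j → sumTo k (λ i → F i j))
  sumTo-comm l F = begin
    sumTo k (λ i → sumTo l (F i))
      ≡⟨ trans (sumTo≡sum k _) (sum-cong-≗ {suc k} (λ i → sumTo≡sum l (F (k ∸ toℕ i)))) ⟩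
    ∑[ i < suc k ] ∑[ j < suc l ] F (k ∸ toℕ i) (l ∸ toℕ j)
      ≡⟨ ∑-comm {suc k} {suc l} (λ i j → F (k ∸ toℕ i) (l ∸ toℕ j)) ⟩
    ∑[ j < suc l ] ∑[ i < suc k ] F (k ∸ toℕ i) (l ∸ toℕ j)
      ≡⟨ trans (sumTo≡sum l _) (sum-cong-≗ {suc l} (λ j → sumTo≡sum k (λ i → F i (l ∸ toℕ j)))) ⟨
    sumTo l (λ j → sumTo k (λ i → F i j))
      ∎
    where open ≡-Reasoning

  sumTo-sum-comm : ∀ {n} (F : ℕ → Fin n → ℤ) →
                   sumTo k (λ i → sum (F i)) ≡ sum (λ w → sumTo k (λ i → F i w))
  sumTo-sum-comm {n} F = begin
    sumTo k (λ i → sum (F i))                  ≡⟨ sumTo≡sum k _ ⟩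
    ∑[ i < suc k ] sum (F (k ∸ toℕ i))         ≡⟨ ∑-comm {suc k} {n} (λ i → F (k ∸ toℕ i)) ⟩
    sum (λ w → ∑[ i < suc k ] F (k ∸ toℕ i) w) ≡⟨ sum-cong-≗ {n} (λ w → sumTo≡sum k (λ i → F i w)) ⟨
    sum (λ w → sumTo k (λ i → F i w))          ∎
    where open ≡-Reasoning

sumTo-single : ∀ {K t} {F : ℕ → ℤ} → t ℕ.≤ K →
               (∀ j → j ℕ.≤ K → j ≢ t → F j ≡ 0ℤ) → sumTo K F ≡ F t
sumTo-single {zero} z≤n _ = refl
sumTo-single {suc K} {t} {F} t≤1+K vanish with ℕP.m≤n⇒m<n∨m≡n t≤1+K
... | inj₁ t<1+K = trans (cong₂ _+_ (vanish (suc K) ℕP.≤-refl (ℕP.<⇒≢ t<1+K ∘ sym))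
                                    (sumTo-single (ℕP.≤-pred t<1+K) (λ j j≤K → vanish j (ℕP.m≤n⇒m≤1+n j≤K))))
                         (ℤP.+-identityˡ (F t))
... | inj₂ refl  = trans (cong (F t +_) (sumTo-zero K λ j j≤K → vanish j (ℕP.m≤n⇒m≤1+n j≤K) (ℕP.<⇒≢ (s≤s j≤K))))
                         (ℤP.+-identityʳ (F t))

sumTo-δ : ∀ K t (X : ℕ → ℤ) → sumTo K (λ j → 𝟙 (t ℕ.≟ j) (X j)) ≡ 𝟙 (t ℕ.≤? K) (X t)
sumTo-δ K t X with t ℕ.≤? K
... | yes t≤K = trans (sumTo-single t≤K (λ j _ j≢t → 𝟙-no (t ℕ.≟ j) (j≢t ∘ sym))) (𝟙-yes (t ℕ.≟ t) refl)
... | no  t≰K = sumTo-zero K (λ j j≤K → 𝟙-no (t ℕ.≟ j) (λ { refl → t≰K j≤K }))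

sumTo-truncate : ∀ {m K} (F : ℕ → ℤ) → m ℕ.≤ K → (∀ i → m ℕ.< i → F i ≡ 0ℤ) → sumTo K F ≡ sumTo m F
sumTo-truncate {m} {K} F m≤K vanish with ℕP.m≤n⇒∃[o]m+o≡n m≤K
... | d , refl = go d
  where
  go : ∀ d → sumTo (m ℕ.+ d) F ≡ sumTo m F
  go zero    = cong (λ n → sumTo n F) (ℕP.+-identityʳ m)
  go (suc d) rewrite ℕP.+-suc m d =
    trans (cong₂ _+_ (vanish _ (s≤s (ℕP.m≤m+n m d))) (go d)) (ℤP.+-identityˡ _)

sumTo-extend : ∀ {k K} (F : ℕ → ℤ) → k ℕ.≤ K → sumTo K (λ i → 𝟙 (i ℕ.≤? k) (F i)) ≡ sumTo k F
sumTo-extend {k} F k≤K =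
  trans (sumTo-truncate _ k≤K (λ i k<i → 𝟙-no (i ℕ.≤? k) (ℕP.<⇒≱ k<i)))
        (sumTo-cong k (λ i i≤k → 𝟙-yes (i ℕ.≤? k) i≤k))

sumTo-reflect : ∀ k (F : ℕ → ℤ) → sumTo k (λ i → F (k ∸ i)) ≡ sumTo k F
sumTo-reflect k F = begin
  sumTo k (λ i → F (k ∸ i))                     ≡⟨ sumTo≡sum k _ ⟩
  ∑[ i < suc k ] F (k ∸ (k ∸ toℕ i))
    ≡⟨ sum-cong-≗ {suc k} (cong (λ j → F (k ∸ j)) ∘ sym ∘ opposite-prop) ⟩
  ∑[ i < suc k ] F (k ∸ toℕ (Fin.opposite i))   ≡⟨ sum-permute {suc k} (λ i → F (k ∸ toℕ i)) reverse ⟨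
  ∑[ i < suc k ] F (k ∸ toℕ i)                  ≡⟨ sumTo≡sum k F ⟨
  sumTo k F                                     ∎
  where open ≡-Reasoning

*ₚ-cong : ∀ {a a' b b' : Poly} k → (∀ i → a i ≡ a' i) → (∀ i → b i ≡ b' i) → (a *ₚ b) k ≡ (a' *ₚ b') k
*ₚ-cong k ea eb = sumTo-cong k (λ i _ → cong₂ _*_ (ea i) (eb (k ∸ i)))

oneₚ-positive : ∀ {n} → 0 ℕ.< n → oneₚ n ≡ 0ℤ
oneₚ-positive {suc _} _ = refl

oneₚ-*ₚ : ∀ (a : Poly) k → (oneₚ *ₚ a) k ≡ a k
oneₚ-*ₚ a k = trans (sumTo-single z≤n vanish) (ℤP.*-identityˡ (a k))
  where
  vanish : ∀ i → i ℕ.≤ k → i ≢ 0 → oneₚ i * a (k ∸ i) ≡ 0ℤ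
  vanish zero    _ 0≢0 = ⊥-elim (0≢0 refl)
  vanish (suc i) _ _   = refl

*ₚ-oneₚ : ∀ (a : Poly) k → (a *ₚ oneₚ) k ≡ a k
*ₚ-oneₚ a k = begin
  (a *ₚ oneₚ) k         ≡⟨ sumTo-single ℕP.≤-refl vanish ⟩
  a k * oneₚ (k ∸ k)    ≡⟨ cong (λ n → a k * oneₚ n) (ℕP.n∸n≡0 k) ⟩
  a k * 1ℤ              ≡⟨ ℤP.*-identityʳ (a k) ⟩
  a k                   ∎
  where
  open ≡-Reasoning
  vanish : ∀ i → i ℕ.≤ k → i ≢ k → a i * oneₚ (k ∸ i) ≡ 0ℤ
  vanish i i≤k i≢k = trans (cong (a i *_) (oneₚ-positive (ℕP.m<n⇒0<n∸m (ℕP.≤∧≢⇒< i≤k i≢k))))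
                           (ℤP.*-zeroʳ (a i))

zeroₚ-*ₚ : ∀ (a : Poly) k → (zeroₚ *ₚ a) k ≡ 0ℤ
zeroₚ-*ₚ a k = sumTo-zero k (λ _ _ → refl)

*ₚ-zeroₚ : ∀ (a : Poly) k → (a *ₚ zeroₚ) k ≡ 0ℤ
*ₚ-zeroₚ a k = sumTo-zero k (λ i _ → ℤP.*-zeroʳ (a i))

*ₚ-scale : ∀ (a b : Poly) c d k →
           ((λ i → c * a i) *ₚ (λ i → d * b i)) k ≡ (c * d) * (a *ₚ b) k
*ₚ-scale a b c d k = trans (sumTo-cong k (λ i _ → regroup c (a i) d (b (k ∸ i))))
                           (sym (sumTo-*ˡ k (c * d) _))
  where
  regroup : ∀ (c a d b : ℤ) → c * a * (d * b) ≡ c * d * (a * b)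
  regroup = solve-∀

*ₚ-𝟙ˡ : ∀ {P} (d : Dec P) (a b : Poly) k → ((λ i → 𝟙 d (a i)) *ₚ b) k ≡ 𝟙 d ((a *ₚ b) k)
*ₚ-𝟙ˡ (yes _) a b k = refl
*ₚ-𝟙ˡ (no _)  a b k = zeroₚ-*ₚ b k

*ₚ-𝟙ʳ : ∀ {P} (d : Dec P) (a b : Poly) k → (a *ₚ (λ i → 𝟙 d (b i))) k ≡ 𝟙 d ((a *ₚ b) k)
*ₚ-𝟙ʳ (yes _) a b k = refl
*ₚ-𝟙ʳ (no _)  a b k = *ₚ-zeroₚ a k

*ₚ-sumˡ : ∀ {n} (a : Fin n → Poly) (b : Poly) k →
          ((λ i → sum (λ v → a v i)) *ₚ b) k ≡ sum (λ v → (a v *ₚ b) k)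
*ₚ-sumˡ {n} a b k = trans (sumTo-cong k (λ i _ → *-distribʳ-sum {n} (b (k ∸ i)) (λ v → a v i)))
                          (sumTo-sum-comm k (λ i v → a v i * b (k ∸ i)))

*ₚ-sumʳ : ∀ {n} (a : Poly) (b : Fin n → Poly) k →
          (a *ₚ (λ i → sum (λ v → b v i))) k ≡ sum (λ v → (a *ₚ b v) k)
*ₚ-sumʳ {n} a b k = trans (sumTo-cong k (λ i _ → *-distribˡ-sum {n} (a i) (λ v → b v (k ∸ i))))
                          (sumTo-sum-comm k (λ i v → a i * b v (k ∸ i)))

sumTo-δ-∸ : ∀ {n K} i (X : ℕ → ℤ) → n ℕ.≤ K →
             sumTo K (λ j → 𝟙 (i ℕ.+ j ℕ.≟ n) (X j)) ≡ 𝟙 (i ℕ.≤? n) (X (n ∸ i))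
sumTo-δ-∸ {n} {K} i X n≤K with i ℕ.≤? n
... | yes i≤n = begin
  sumTo K (λ j → 𝟙 (i ℕ.+ j ℕ.≟ n) (X j))  ≡⟨ sumTo-cong K (λ j _ →
                                               𝟙-⇔ (i ℕ.+ j ℕ.≟ n) (n ∸ i ℕ.≟ j) to from) ⟩
  sumTo K (λ j → 𝟙 (n ∸ i ℕ.≟ j) (X j))    ≡⟨ sumTo-δ K (n ∸ i) X ⟩
  𝟙 (n ∸ i ℕ.≤? K) (X (n ∸ i))             ≡⟨ 𝟙-yes (n ∸ i ℕ.≤? K) (ℕP.≤-trans (ℕP.m∸n≤m n i) n≤K) ⟩
  X (n ∸ i)                                ∎
  where
  open ≡-Reasoning
  to : ∀ {j} → i ℕ.+ j ≡ n → n ∸ i ≡ j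
  to {j} refl = ℕP.m+n∸m≡n i j
  from : ∀ {j} → n ∸ i ≡ j → i ℕ.+ j ≡ n
  from refl = ℕP.m+[n∸m]≡n i≤n
... | no i≰n = sumTo-zero K (λ j _ → 𝟙-no (i ℕ.+ j ℕ.≟ n) (λ { refl → i≰n (ℕP.m≤m+n i j) }))

-- Summing over a whole box [0,K]² under an indicator keeps reindexings free of truncated
-- subtraction.
*ₚ-box : ∀ (a b : Poly) {k K} → k ℕ.≤ K →
         (a *ₚ b) k ≡ sumTo K (λ i → sumTo K (λ j → 𝟙 (i ℕ.+ j ℕ.≟ k) (a i * b j)))
*ₚ-box a b {k} {K} k≤K = sym (begin
  sumTo K (λ i → sumTo K (λ j → 𝟙 (i ℕ.+ j ℕ.≟ k) (a i * b j)))
    ≡⟨ sumTo-cong K (λ i _ → sumTo-δ-∸ i (λ j → a i * b j) k≤K) ⟩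
  sumTo K (λ i → 𝟙 (i ℕ.≤? k) (a i * b (k ∸ i)))
    ≡⟨ sumTo-extend (λ i → a i * b (k ∸ i)) k≤K ⟩
  (a *ₚ b) k
    ∎)
  where open ≡-Reasoning

*ₚ-assoc : ∀ (a b c : Poly) k → ((a *ₚ b) *ₚ c) k ≡ (a *ₚ (b *ₚ c)) k
*ₚ-assoc a b c k = begin
  sumTo k (λ m → (a *ₚ b) m * c (k ∸ m))
    ≡⟨ sumTo-cong k expand ⟩
  sumTo k (λ m → sumTo k (λ i → sumTo k (λ j → 𝟙 (i ℕ.+ j ℕ.≟ m) (a i * b j * c (k ∸ m)))))
    ≡⟨ trans (sumTo-comm k k _) (sumTo-cong k (λ i _ → sumTo-comm k k _)) ⟩
  sumTo k (λ i → sumTo k (λ j → sumTo k (λ m → 𝟙 (i ℕ.+ j ℕ.≟ m) (a i * b j * c (k ∸ m)))))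
    ≡⟨ sumTo-cong k (λ i _ → sumTo-cong k (λ j _ → sumTo-δ k (i ℕ.+ j) _)) ⟩
  sumTo k (λ i → sumTo k (λ j → 𝟙 (i ℕ.+ j ℕ.≤? k) (a i * b j * c (k ∸ (i ℕ.+ j)))))
    ≡⟨ sumTo-cong k (λ i i≤k → sumTo-cong k (λ j _ → reassociate i j i≤k)) ⟩
  sumTo k (λ i → sumTo k (λ j → 𝟙 (j ℕ.≤? k ∸ i) (a i * (b j * c (k ∸ i ∸ j)))))
    ≡⟨ sumTo-cong k (λ i _ → trans (sumTo-cong k (λ j _ → sym (𝟙-*ˡ (j ℕ.≤? k ∸ i) (a i))))
                                   (sym (sumTo-*ˡ k (a i) _))) ⟩
  sumTo k (λ i → a i * sumTo k (λ j → 𝟙 (j ℕ.≤? k ∸ i) (b j * c (k ∸ i ∸ j))))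
    ≡⟨ sumTo-cong k (λ i _ → cong (a i *_) (sumTo-extend _ (ℕP.m∸n≤m k i))) ⟩
  sumTo k (λ i → a i * (b *ₚ c) (k ∸ i))
    ∎
  where
  open ≡-Reasoning
  expand : ∀ m → m ℕ.≤ k → (a *ₚ b) m * c (k ∸ m) ≡
           sumTo k (λ i → sumTo k (λ j → 𝟙 (i ℕ.+ j ℕ.≟ m) (a i * b j * c (k ∸ m))))
  expand m m≤k = begin
    (a *ₚ b) m * c (k ∸ m)
      ≡⟨ cong (_* c (k ∸ m)) (*ₚ-box a b m≤k) ⟩
    sumTo k (λ i → sumTo k (λ j → 𝟙 (i ℕ.+ j ℕ.≟ m) (a i * b j))) * c (k ∸ m)
      ≡⟨ trans (sumTo-*ʳ k _ _) (sumTo-cong k (λ i _ → trans (sumTo-*ʳ k _ _)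
           (sumTo-cong k (λ j _ → 𝟙-*ʳ (i ℕ.+ j ℕ.≟ m) (c (k ∸ m)))))) ⟩
    sumTo k (λ i → sumTo k (λ j → 𝟙 (i ℕ.+ j ℕ.≟ m) (a i * b j * c (k ∸ m))))
      ∎
    where open ≡-Reasoning
  reassociate : ∀ i j → i ℕ.≤ k →
    𝟙 (i ℕ.+ j ℕ.≤? k) (a i * b j * c (k ∸ (i ℕ.+ j))) ≡ 𝟙 (j ℕ.≤? k ∸ i) (a i * (b j * c (k ∸ i ∸ j)))
  reassociate i j i≤k = trans
    (𝟙-⇔ (i ℕ.+ j ℕ.≤? k) (j ℕ.≤? k ∸ i)
       (λ i+j≤k → ℕP.m+n≤o⇒m≤o∸n j (subst (ℕ._≤ k) (ℕP.+-comm i j) i+j≤k))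
       (λ j≤k∸i → subst (ℕ._≤ k) (ℕP.+-comm j i) (ℕP.m≤o∸n⇒m+n≤o j i≤k j≤k∸i)))
    (𝟙-cong (j ℕ.≤? k ∸ i) (λ _ → trans (ℤP.*-assoc (a i) (b j) _)
       (cong (λ n → a i * (b j * c n)) (sym (ℕP.∸-+-assoc k i j)))))

DegreeAtMost : ℕ → Poly → Set
DegreeAtMost m a = ∀ i → m ℕ.< i → a i ≡ 0ℤ

revₚ : ℕ → Poly → Poly
revₚ m a k = 𝟙 (k ℕ.≤? m) (a (m ∸ k))

revₚ-degree : ∀ m a → DegreeAtMost m (revₚ m a)
revₚ-degree m a i m<i = 𝟙-no (i ℕ.≤? m) (ℕP.<⇒≱ m<i)

*ₚ-box-degree : ∀ {m n} {a b : Poly} → DegreeAtMost m a → DegreeAtMost n b → ∀ k →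
                (a *ₚ b) k ≡ sumTo m (λ i → sumTo n (λ j → 𝟙 (i ℕ.+ j ℕ.≟ k) (a i * b j)))
*ₚ-box-degree {m} {n} {a} {b} deg-a deg-b k = begin
  (a *ₚ b) k
    ≡⟨ *ₚ-box a b (ℕP.m≤m+n k (m ℕ.+ n)) ⟩
  sumTo K (λ i → sumTo K (λ j → 𝟙 (i ℕ.+ j ℕ.≟ k) (a i * b j)))
    ≡⟨ sumTo-truncate _ (ℕP.≤-trans (ℕP.m≤m+n m n) (ℕP.m≤n+m _ k)) (λ i m<i →
         sumTo-zero K (λ j _ → 𝟙-zero (i ℕ.+ j ℕ.≟ k) (λ _ →
           trans (cong (_* b j) (deg-a i m<i)) (ℤP.*-zeroˡ (b j))))) ⟩
  sumTo m (λ i → sumTo K (λ j → 𝟙 (i ℕ.+ j ℕ.≟ k) (a i * b j)))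
    ≡⟨ sumTo-cong m (λ i _ → sumTo-truncate _ (ℕP.≤-trans (ℕP.m≤n+m n m) (ℕP.m≤n+m _ k)) (λ j n<j →
         𝟙-zero (i ℕ.+ j ℕ.≟ k) (λ _ → trans (cong (a i *_) (deg-b j n<j)) (ℤP.*-zeroʳ (a i))))) ⟩
  sumTo m (λ i → sumTo n (λ j → 𝟙 (i ℕ.+ j ℕ.≟ k) (a i * b j)))
    ∎
  where
  open ≡-Reasoning
  K = k ℕ.+ (m ℕ.+ n)

revₚ-*ₚ : ∀ {m n} {a b : Poly} → DegreeAtMost m a → DegreeAtMost n b → ∀ k →
          revₚ (m ℕ.+ n) (a *ₚ b) k ≡ (revₚ m a *ₚ revₚ n b) k
revₚ-*ₚ {m} {n} {a} {b} deg-a deg-b k = begin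
  𝟙 (k ℕ.≤? N) ((a *ₚ b) (N ∸ k))
    ≡⟨ cong (𝟙 (k ℕ.≤? N)) (*ₚ-box-degree deg-a deg-b (N ∸ k)) ⟩
  𝟙 (k ℕ.≤? N) (sumTo m (λ i → sumTo n (λ j → 𝟙 (i ℕ.+ j ℕ.≟ N ∸ k) (a i * b j))))
    ≡⟨ trans (sumTo-cong m (λ i _ → sumTo-𝟙 n (k ℕ.≤? N) _)) (sumTo-𝟙 m (k ℕ.≤? N) _) ⟨
  sumTo m (λ i → sumTo n (λ j → 𝟙 (k ℕ.≤? N) (𝟙 (i ℕ.+ j ℕ.≟ N ∸ k) (a i * b j))))
    ≡⟨ sumTo-cong m (λ i i≤m → sumTo-cong n (λ j j≤n → reflectedExponent i≤m j≤n)) ⟩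
  sumTo m (λ i → sumTo n (λ j → G (m ∸ i) (n ∸ j)))
    ≡⟨ trans (sumTo-cong m (λ i _ → sumTo-reflect n (G (m ∸ i))))
             (sumTo-reflect m (λ i → sumTo n (G i))) ⟩
  sumTo m (λ i → sumTo n (λ j → G i j))
    ≡⟨ sumTo-cong m (λ i i≤m → sumTo-cong n (λ j j≤n → 𝟙-cong (i ℕ.+ j ℕ.≟ k) (λ _ →
         cong₂ _*_ (sym (𝟙-yes (i ℕ.≤? m) i≤m)) (sym (𝟙-yes (j ℕ.≤? n) j≤n))))) ⟩
  sumTo m (λ i → sumTo n (λ j → 𝟙 (i ℕ.+ j ℕ.≟ k) (revₚ m a i * revₚ n b j)))
    ≡⟨ *ₚ-box-degree (revₚ-degree m a) (revₚ-degree n b) k ⟨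
  (revₚ m a *ₚ revₚ n b) k
    ∎
  where
  open ≡-Reasoning
  N = m ℕ.+ n
  G : ℕ → ℕ → ℤ
  G i j = 𝟙 (i ℕ.+ j ℕ.≟ k) (a (m ∸ i) * b (n ∸ j))
  reflectedExponent : ∀ {i j} → i ℕ.≤ m → j ℕ.≤ n →
    𝟙 (k ℕ.≤? N) (𝟙 (i ℕ.+ j ℕ.≟ N ∸ k) (a i * b j)) ≡ G (m ∸ i) (n ∸ j)
  reflectedExponent {i} {j} i≤m j≤n =
    𝟙-𝟙-⇔ (k ℕ.≤? N) (i ℕ.+ j ℕ.≟ N ∸ k) ((m ∸ i) ℕ.+ (n ∸ j) ℕ.≟ k) to from
      (λ _ → sym (cong₂ _*_ (cong a (ℕP.m∸[m∸n]≡n i≤m)) (cong b (ℕP.m∸[m∸n]≡n j≤n))))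
    where
    i+j≤N = ℕP.+-mono-≤ i≤m j≤n
    to : k ℕ.≤ N × i ℕ.+ j ≡ N ∸ k → (m ∸ i) ℕ.+ (n ∸ j) ≡ k
    to (k≤N , eq) = trans (∸-+-∸ i≤m j≤n) (trans (cong (N ∸_) eq) (ℕP.m∸[m∸n]≡n k≤N))
    from : (m ∸ i) ℕ.+ (n ∸ j) ≡ k → k ℕ.≤ N × i ℕ.+ j ≡ N ∸ k
    from eq rewrite sym eq | ∸-+-∸ i≤m j≤n = ℕP.m∸n≤m N (i ℕ.+ j) , sym (ℕP.m∸[m∸n]≡n i+j≤N)

module Incidence (B : FinPoset) where
  open FinPoset B
  private module ≤ = IsDecPartialOrder isDPO

  infixl 7 _·_
  infix  4 _≈_

  _·_ : Inc B → Inc B → Inc B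
  _·_ = _·ᴵ_ B

  _≈_ : Inc B → Inc B → Set
  _≈_ = _≈ᴵ_ B

  δ : Inc B
  δ = δᴵ B

  ≈-setoid : Setoid 0ℓ 0ℓ
  ≈-setoid = record
    { Carrier       = Inc B
    ; _≈_           = _≈_
    ; isEquivalence = record
      { refl  = λ _ _ _ _ → refl
      ; sym   = λ p≈q z z' z≤z' k → sym (p≈q z z' z≤z' k)
      ; trans = λ p≈q q≈s z z' z≤z' k → trans (p≈q z z' z≤z' k) (q≈s z z' z≤z' k)
      }
    }

  open Setoid ≈-setoid public using () renaming (refl to ≈-refl; sym to ≈-sym; trans to ≈-trans)

  <-wellFounded : WellFounded _<_
  <-wellFounded = po-wellFounded ≤.isPartialOrder

  <-noetherian : WellFounded (flip _<_)
  <-noetherian = po-noetherian ≤.isPartialOrder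

  Unipotent : Inc B → Set
  Unipotent p = ∀ z k → p z z k ≡ oneₚ k

  between? : ∀ z w z' → Dec (z ≤ w × w ≤ z')
  between? z w z' = z ≤? w ×-dec w ≤? z'

  -- The summand of _·ᴵ_ is local to Defs and cannot be named; in the mutual block
  -- ·-as-sum determines it before the clauses of ·-summand are checked.
  mutual
    ·-as-sum : ∀ p q z z' k → (p · q) z z' k ≡ ∑[ w < size ] 𝟙 (between? z w z') ((p z w *ₚ q w z') k)
    ·-as-sum p q z z' k = sumFin≗sum (·-summand p q z z' k)

    ·-summand : ∀ p q z z' k w → _ ≡ 𝟙 (between? z w z') ((p z w *ₚ q w z') k)
    ·-summand p q z z' k w with z ≤? w | w ≤? z'
    ... | yes _ | yes _ = refl
    ... | yes _ | no _  = refl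
    ... | no _  | _     = refl

  ·-cong : ∀ {p p' q q'} → p ≈ p' → q ≈ q' → p · q ≈ p' · q'
  ·-cong {p} {p'} {q} {q'} p≈p' q≈q' z z' _ k = begin
    (p · q) z z' k
      ≡⟨ ·-as-sum p q z z' k ⟩
    ∑[ w < size ] 𝟙 (between? z w z') ((p z w *ₚ q w z') k)
      ≡⟨ sum-cong-≗ {size} (λ w → 𝟙-cong (between? z w z') λ (z≤w , w≤z') →
           *ₚ-cong k (p≈p' z w z≤w) (q≈q' w z' w≤z')) ⟩
    ∑[ w < size ] 𝟙 (between? z w z') ((p' z w *ₚ q' w z') k)
      ≡⟨ ·-as-sum p' q' z z' k ⟨
    (p' · q') z z' k
      ∎
    where open ≡-Reasoning

  δ-*ₚ : ∀ z w (a : Poly) k → (δ z w *ₚ a) k ≡ 𝟙 (z ≟ w) (a k)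
  δ-*ₚ z w a k with z ≟ w
  ... | yes _ = oneₚ-*ₚ a k
  ... | no _  = zeroₚ-*ₚ a k

  δ-· : ∀ p → δ · p ≈ p
  δ-· p z z' z≤z' k = begin
    (δ · p) z z' k
      ≡⟨ ·-as-sum δ p z z' k ⟩
    ∑[ w < size ] 𝟙 (between? z w z') ((δ z w *ₚ p w z') k)
      ≡⟨ sum-cong-≗ {size} (λ w → trans (𝟙-cong (between? z w z') (λ _ → δ-*ₚ z w (p w z') k))
           (𝟙-𝟙-⇔ (between? z w z') (z ≟ w) (w ≟ z) (sym ∘ proj₂) (λ { refl → (≤.refl , z≤z') , refl })
             (λ { (_ , refl) → refl }))) ⟩
    ∑[ w < size ] 𝟙 (w ≟ z) (p z z' k)
      ≡⟨ sum-δ z (p z z' k) ⟩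
    p z z' k
      ∎
    where open ≡-Reasoning

  Unipotent-· : ∀ {p q} → Unipotent p → Unipotent q → Unipotent (p · q)
  Unipotent-· {p} {q} p-unit q-unit z k = begin
    (p · q) z z k
      ≡⟨ ·-as-sum p q z z k ⟩
    ∑[ w < size ] 𝟙 (between? z w z) ((p z w *ₚ q w z) k)
      ≡⟨ sum-cong-≗ {size} (λ w → 𝟙-⇔ (between? z w z) (w ≟ z)
           (λ (z≤w , w≤z) → ≤.antisym w≤z z≤w) (λ { refl → ≤.refl , ≤.refl })) ⟩
    ∑[ w < size ] 𝟙 (w ≟ z) ((p z w *ₚ q w z) k)
      ≡⟨ sum-cong-≗ {size} (λ w → 𝟙-cong (w ≟ z) λ { refl →
           trans (*ₚ-cong k (p-unit w) (q-unit w)) (oneₚ-*ₚ oneₚ k) }) ⟩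
    ∑[ w < size ] 𝟙 (w ≟ z) (oneₚ k)
      ≡⟨ sum-δ z (oneₚ k) ⟩
    oneₚ k
      ∎
    where open ≡-Reasoning

  ·-*ₚˡ : ∀ p q z w (c : Poly) k →
          ((p · q) z w *ₚ c) k ≡ ∑[ v < size ] 𝟙 (between? z v w) (((p z v *ₚ q v w) *ₚ c) k)
  ·-*ₚˡ p q z w c k = begin
    ((p · q) z w *ₚ c) k
      ≡⟨ *ₚ-cong {(p · q) z w} {b = c} {c} k (·-as-sum p q z w) (λ _ → refl) ⟩
    ((λ i → ∑[ v < size ] 𝟙 (between? z v w) ((p z v *ₚ q v w) i)) *ₚ c) k
      ≡⟨ *ₚ-sumˡ (λ v i → 𝟙 (between? z v w) ((p z v *ₚ q v w) i)) c k ⟩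
    ∑[ v < size ] ((λ i → 𝟙 (between? z v w) ((p z v *ₚ q v w) i)) *ₚ c) k
      ≡⟨ sum-cong-≗ {size} (λ v → *ₚ-𝟙ˡ (between? z v w) (p z v *ₚ q v w) c k) ⟩
    ∑[ v < size ] 𝟙 (between? z v w) (((p z v *ₚ q v w) *ₚ c) k)
      ∎
    where open ≡-Reasoning

  *ₚ-·ʳ : ∀ (c : Poly) q s v z' k →
          (c *ₚ (q · s) v z') k ≡ ∑[ w < size ] 𝟙 (between? v w z') ((c *ₚ (q v w *ₚ s w z')) k)
  *ₚ-·ʳ c q s v z' k = begin
    (c *ₚ (q · s) v z') k
      ≡⟨ *ₚ-cong {c} {c} {(q · s) v z'} k (λ _ → refl) (·-as-sum q s v z') ⟩
    (c *ₚ (λ i → ∑[ w < size ] 𝟙 (between? v w z') ((q v w *ₚ s w z') i))) k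
      ≡⟨ *ₚ-sumʳ c (λ w i → 𝟙 (between? v w z') ((q v w *ₚ s w z') i)) k ⟩
    ∑[ w < size ] (c *ₚ (λ i → 𝟙 (between? v w z') ((q v w *ₚ s w z') i))) k
      ≡⟨ sum-cong-≗ {size} (λ w → *ₚ-𝟙ʳ (between? v w z') c (q v w *ₚ s w z') k) ⟩
    ∑[ w < size ] 𝟙 (between? v w z') ((c *ₚ (q v w *ₚ s w z')) k)
      ∎
    where open ≡-Reasoning

  ·-assoc : ∀ p q s → (p · q) · s ≈ p · (q · s)
  ·-assoc p q s z z' _ k = begin
    ((p · q) · s) z z' k
      ≡⟨ ·-as-sum (p · q) s z z' k ⟩
    ∑[ w < size ] 𝟙 (between? z w z') (((p · q) z w *ₚ s w z') k)
      ≡⟨ sum-cong-≗ {size} (λ w → cong (𝟙 (between? z w z')) (·-*ₚˡ p q z w (s w z') k)) ⟩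
    ∑[ w < size ] 𝟙 (between? z w z') (∑[ v < size ] 𝟙 (between? z v w) (L v w))
      ≡⟨ sum-cong-≗ {size} (λ w → sum-𝟙 (between? z w z') (λ v → 𝟙 (between? z v w) (L v w))) ⟨
    ∑[ w < size ] ∑[ v < size ] 𝟙 (between? z w z') (𝟙 (between? z v w) (L v w))
      ≡⟨ ∑-comm {size} {size} (λ w v → 𝟙 (between? z w z') (𝟙 (between? z v w) (L v w))) ⟩
    ∑[ v < size ] ∑[ w < size ] 𝟙 (between? z w z') (𝟙 (between? z v w) (L v w))
      ≡⟨ sum-cong-≗ {size} (λ v → sum-cong-≗ {size} (λ w → 𝟙-𝟙-⇔ (between? z w z') (between? z v w)
           (between? z v z' ×-dec between? v w z') reorder reorder⁻¹
           (λ _ → *ₚ-assoc (p z v) (q v w) (s w z') k))) ⟩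
    ∑[ v < size ] ∑[ w < size ] 𝟙 (between? z v z' ×-dec between? v w z') (R v w)
      ≡⟨ sum-cong-≗ {size} (λ v → sum-cong-≗ {size} (λ w → sym (𝟙-𝟙 (between? z v z') (between? v w z')))) ⟩
    ∑[ v < size ] ∑[ w < size ] 𝟙 (between? z v z') (𝟙 (between? v w z') (R v w))
      ≡⟨ sum-cong-≗ {size} (λ v → sum-𝟙 (between? z v z') (λ w → 𝟙 (between? v w z') (R v w))) ⟩
    ∑[ v < size ] 𝟙 (between? z v z') (∑[ w < size ] 𝟙 (between? v w z') (R v w))
      ≡⟨ sum-cong-≗ {size} (λ v → cong (𝟙 (between? z v z')) (*ₚ-·ʳ (p z v) q s v z' k)) ⟨
    ∑[ v < size ] 𝟙 (between? z v z') ((p z v *ₚ (q · s) v z') k)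
      ≡⟨ ·-as-sum p (q · s) z z' k ⟨
    (p · (q · s)) z z' k
      ∎
    where
    open ≡-Reasoning
    L R : Elt → Elt → ℤ
    L v w = ((p z v *ₚ q v w) *ₚ s w z') k
    R v w = (p z v *ₚ (q v w *ₚ s w z')) k
    reorder : ∀ {v w} → (z ≤ w × w ≤ z') × (z ≤ v × v ≤ w) → (z ≤ v × v ≤ z') × (v ≤ w × w ≤ z')
    reorder ((_ , w≤z') , (z≤v , v≤w)) = (z≤v , ≤.trans v≤w w≤z') , (v≤w , w≤z')
    reorder⁻¹ : ∀ {v w} → (z ≤ v × v ≤ z') × (v ≤ w × w ≤ z') → (z ≤ w × w ≤ z') × (z ≤ v × v ≤ w)
    reorder⁻¹ ((z≤v , _) , (v≤w , w≤z')) = (≤.trans z≤v v≤w , w≤z') , (z≤v , v≤w)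

  -- By induction on the interval only the terms w = z and w = u of (h·h)(z,u) survive, so
  -- h(z,u) = 2·h(z,u).
  ·-idempotent⇒δ : ∀ h → Unipotent h → h · h ≈ h → h ≈ δ
  ·-idempotent⇒δ h h-unit hh≈h z z' z≤z' k with z ≟ z'
  ... | yes refl = h-unit z k
  ... | no z≢z'  = vanish z' (<-wellFounded z') (z≤z' , z≢z') k
    where
    vanish : ∀ u → Acc _<_ u → z < u → ∀ k → h z u k ≡ 0ℤ
    vanish u (acc below) (z≤u , z≢u) k = x≡x+x⇒x≡0 (begin
      h z u k
        ≡⟨ hh≈h z u z≤u k ⟨
      (h · h) z u k
        ≡⟨ ·-as-sum h h z u k ⟩
      ∑[ w < size ] 𝟙 (between? z w u) ((h z w *ₚ h w u) k)
        ≡⟨ sum-cong-≗ {size} summand ⟩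
      ∑[ w < size ] (𝟙 (w ≟ z) (h z u k) + 𝟙 (w ≟ u) (h z u k))
        ≡⟨ ∑-distrib-+ {size} (λ w → 𝟙 (w ≟ z) (h z u k)) (λ w → 𝟙 (w ≟ u) (h z u k)) ⟩
      ∑[ w < size ] 𝟙 (w ≟ z) (h z u k) + ∑[ w < size ] 𝟙 (w ≟ u) (h z u k)
        ≡⟨ cong₂ _+_ (sum-δ z (h z u k)) (sum-δ u (h z u k)) ⟩
      h z u k + h z u k
        ∎)
      where
      open ≡-Reasoning
      summand : ∀ w → 𝟙 (between? z w u) ((h z w *ₚ h w u) k) ≡ 𝟙 (w ≟ z) (h z u k) + 𝟙 (w ≟ u) (h z u k)
      summand w with w ≟ z | w ≟ u
      ... | yes refl | yes refl = ⊥-elim (z≢u refl)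
      ... | yes refl | no _     = begin
        𝟙 (between? w w u) ((h w w *ₚ h w u) k) ≡⟨ 𝟙-yes (between? w w u) (≤.refl , z≤u) ⟩
        (h w w *ₚ h w u) k                      ≡⟨ *ₚ-cong {b = h w u} {h w u} k (h-unit w) (λ _ → refl) ⟩
        (oneₚ *ₚ h w u) k                       ≡⟨ oneₚ-*ₚ (h w u) k ⟩
        h w u k                                 ≡⟨ ℤP.+-identityʳ (h w u k) ⟨
        h w u k + 0ℤ                            ∎
      ... | no _     | yes refl = begin
        𝟙 (between? z w w) ((h z w *ₚ h w w) k) ≡⟨ 𝟙-yes (between? z w w) (z≤u , ≤.refl) ⟩
        (h z w *ₚ h w w) k                      ≡⟨ *ₚ-cong {h z w} {h z w} k (λ _ → refl) (h-unit w) ⟩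
        (h z w *ₚ oneₚ) k                       ≡⟨ *ₚ-oneₚ (h z w) k ⟩
        h z w k                                 ≡⟨ ℤP.+-identityˡ (h z w k) ⟨
        0ℤ + h z w k                            ∎
      ... | no w≢z   | no w≢u   = 𝟙-zero (between? z w u) λ (z≤w , w≤u) →
        trans (*ₚ-cong {a' = zeroₚ} {h w u} {h w u} k
                 (vanish w (below (w≤u , w≢u)) (z≤w , w≢z ∘ sym)) (λ _ → refl))
              (zeroₚ-*ₚ (h w u) k)

  ·-inverse-flip : ∀ {p q} → q · p ≈ δ → Unipotent (p · q) → p · q ≈ δ
  ·-inverse-flip {p} {q} qp≈δ pq-unit = ·-idempotent⇒δ (p · q) pq-unit (begin
    (p · q) · (p · q) ≈⟨ ·-assoc p q (p · q) ⟩
    p · (q · (p · q)) ≈⟨ ·-cong ≈-refl (≈-sym (·-assoc q p q)) ⟩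
    p · ((q · p) · q) ≈⟨ ·-cong ≈-refl (·-cong qp≈δ ≈-refl) ⟩
    p · (δ · q)       ≈⟨ ·-cong ≈-refl (δ-· q) ⟩
    p · q             ∎)
    where open SetoidReasoning ≈-setoid

  rev-as-revₚ : ∀ r p z z' k → rev B r p z z' k ≡ revₚ (r z z') (p z z') k
  rev-as-revₚ r p z z' k with k ℕ.≤? r z z'
  ... | yes _ = refl
  ... | no _  = refl

  module WeakRank (r : Elt → Elt → ℕ) (r-weak : IsWeakRank B r) where

    r-additive : ∀ {z w z'} → z ≤ w → w ≤ z' → r z z' ≡ r z w ℕ.+ r w z'
    r-additive = proj₂ r-weak _ _ _

    r-refl : ∀ z → r z z ≡ 0
    r-refl z = ℕP.+-cancelˡ-≡ (r z z) (r z z) 0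
      (trans (sym (r-additive ≤.refl ≤.refl)) (sym (ℕP.+-identityʳ (r z z))))

    rev-· : ∀ p q → InCalI B r p → InCalI B r q → rev B r (p · q) ≈ rev B r p · rev B r q
    rev-· p q p-deg q-deg z z' _ k = begin
      rev B r (p · q) z z' k
        ≡⟨ rev-as-revₚ r (p · q) z z' k ⟩
      𝟙 (k ℕ.≤? r z z') ((p · q) z z' (r z z' ∸ k))
        ≡⟨ cong (𝟙 (k ℕ.≤? r z z')) (·-as-sum p q z z' (r z z' ∸ k)) ⟩
      𝟙 (k ℕ.≤? r z z') (∑[ w < size ] 𝟙 (between? z w z') ((p z w *ₚ q w z') (r z z' ∸ k)))
        ≡⟨ sum-𝟙 {size} (k ℕ.≤? r z z') _ ⟨
      ∑[ w < size ] 𝟙 (k ℕ.≤? r z z') (𝟙 (between? z w z') ((p z w *ₚ q w z') (r z z' ∸ k)))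
        ≡⟨ sum-cong-≗ {size} (λ w → 𝟙-swap (k ℕ.≤? r z z') (between? z w z')) ⟩
      ∑[ w < size ] 𝟙 (between? z w z') (revₚ (r z z') (p z w *ₚ q w z') k)
        ≡⟨ sum-cong-≗ {size} (λ w → 𝟙-cong (between? z w z') λ (z≤w , w≤z') → begin
             revₚ (r z z') (p z w *ₚ q w z') k
               ≡⟨ cong (λ n → revₚ n (p z w *ₚ q w z') k) (r-additive z≤w w≤z') ⟩
             revₚ (r z w ℕ.+ r w z') (p z w *ₚ q w z') k
               ≡⟨ revₚ-*ₚ (p-deg z w z≤w) (q-deg w z' w≤z') k ⟩
             (revₚ (r z w) (p z w) *ₚ revₚ (r w z') (q w z')) k
               ≡⟨ *ₚ-cong k (sym ∘ rev-as-revₚ r p z w) (sym ∘ rev-as-revₚ r q w z') ⟩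
             (rev B r p z w *ₚ rev B r q w z') k
               ∎) ⟩
      ∑[ w < size ] 𝟙 (between? z w z') ((rev B r p z w *ₚ rev B r q w z') k)
        ≡⟨ ·-as-sum (rev B r p) (rev B r q) z z' k ⟨
      (rev B r p · rev B r q) z z' k
        ∎
      where open ≡-Reasoning

    -- Since r z w ≡ 0 exactly when z ≡ w, the condition 0 < r z w + i exempts only the constant
    -- term on the diagonal; this is what makes the class closed under products.
    HalfVanishing : Inc B → Set
    HalfVanishing p = ∀ z w → z ≤ w → ∀ i → r z w ℕ.≤ 2 ℕ.* i → 0 ℕ.< r z w ℕ.+ i → p z w i ≡ 0ℤ

    InCalIHalf⇒HalfVanishing : ∀ {p} → InCalIHalf B r p → Unipotent p → HalfVanishing p
    InCalIHalf⇒HalfVanishing {p} (_ , p-half) p-unit z w z≤w i r≤2i 0<r+i with z ≟ w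
    ... | yes refl = trans (p-unit z i) (oneₚ-positive (subst (λ n → 0 ℕ.< n ℕ.+ i) (r-refl z) 0<r+i))
    ... | no z≢w   = p-half z w (z≤w , z≢w) i r≤2i

    HalfVanishing-· : ∀ {p q} → HalfVanishing p → HalfVanishing q → HalfVanishing (p · q)
    HalfVanishing-· {p} {q} p-half q-half z z' _ k r≤2k 0<r+k = begin
      (p · q) z z' k
        ≡⟨ ·-as-sum p q z z' k ⟩
      ∑[ w < size ] 𝟙 (between? z w z') ((p z w *ₚ q w z') k)
        ≡⟨ sum-cong-≗ {size} (λ w → 𝟙-zero (between? z w z') λ (z≤w , w≤z') →
             sumTo-zero k (λ i i≤k → summand z≤w w≤z' i≤k)) ⟩
      ∑[ w < size ] 0ℤ
        ≡⟨ sum-replicate-zero size ⟩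
      0ℤ
        ∎
      where
      open ≡-Reasoning
      summand : ∀ {w i} → z ≤ w → w ≤ z' → i ℕ.≤ k → p z w i * q w z' (k ∸ i) ≡ 0ℤ
      summand {w} {i} z≤w w≤z' i≤k
        with half-split {r z w} {r w z'} {i} {k ∸ i}
               (subst₂ ℕ._≤_ (r-additive z≤w w≤z') (cong (2 ℕ.*_) k≡i+[k∸i]) r≤2k)
               (subst₂ (λ m n → 0 ℕ.< m ℕ.+ n) (r-additive z≤w w≤z') k≡i+[k∸i] 0<r+k)
        where k≡i+[k∸i] = sym (ℕP.m+[n∸m]≡n i≤k)
      ... | inj₁ (r≤2i , 0<r+i) = trans (cong (_* q w z' (k ∸ i)) (p-half z w z≤w i r≤2i 0<r+i))
                                        (ℤP.*-zeroˡ (q w z' (k ∸ i)))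
      ... | inj₂ (r≤2j , 0<r+j) = trans (cong (p z w i *_) (q-half w z' w≤z' (k ∸ i) r≤2j 0<r+j))
                                        (ℤP.*-zeroʳ (p z w i))

    -- A coefficient of degree k with 2k < r equals, by self-duality, the one of degree r ∸ k ≥ r/2.
    self-dual⇒δ : ∀ h → Unipotent h → HalfVanishing h → rev B r h ≈ h → h ≈ δ
    self-dual⇒δ h h-unit h-half h-rev z z' z≤z' k with z ≟ z'
    ... | yes refl = h-unit z k
    ... | no z≢z' with r z z' ℕ.≤? 2 ℕ.* k | proj₁ r-weak z z' (z≤z' , z≢z')
    ...   | yes r≤2k | 0<r = h-half z z' z≤z' k r≤2k (ℕP.<-≤-trans 0<r (ℕP.m≤m+n (r z z') k))
    ...   | no  r≰2k | 0<r = begin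
      h z z' k                                ≡⟨ h-rev z z' z≤z' k ⟨
      rev B r h z z' k                        ≡⟨ rev-as-revₚ r h z z' k ⟩
      𝟙 (k ℕ.≤? r z z') (h z z' (r z z' ∸ k)) ≡⟨ 𝟙-zero (k ℕ.≤? r z z') (λ _ → h-half z z' z≤z' (r z z' ∸ k)
                                                   (m≰2n⇒m≤2[m∸n] (r z z') k r≰2k)
                                                   (ℕP.<-≤-trans 0<r (ℕP.m≤m+n (r z z') _))) ⟩
      0ℤ                                      ∎
      where open ≡-Reasoning

  sign-+ : ∀ m n → sign B (m ℕ.+ n) ≡ sign B m * sign B n
  sign-+ zero          n = sym (ℤP.*-identityˡ (sign B n))
  sign-+ (suc zero)    n = sign-suc n
    where
    sign-suc : ∀ n → sign B (suc n) ≡ - 1ℤ * sign B n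
    sign-suc zero          = refl
    sign-suc (suc zero)    = refl
    sign-suc (suc (suc n)) = sign-suc n
  sign-+ (suc (suc m)) n = sign-+ m n

  sign-*-sign : ∀ n → sign B n * sign B n ≡ 1ℤ
  sign-*-sign zero          = refl
  sign-*-sign (suc zero)    = refl
  sign-*-sign (suc (suc n)) = sign-*-sign n

  module Ranked (ρ : Elt → ℕ) (ρ-rank : IsRank B ρ) where

    infixl 9 _ˆ
    _ˆ : Inc B → Inc B
    _ˆ = hat B ρ

    ε : Elt → Elt → ℤ
    ε z z' = sign B (ρ z' ∸ ρ z)

    private
      _<?_ : ∀ z z' → Dec (z < z')
      z <? z' = z ≤? z' ×-dec ¬? (z ≟ z')

    cover-below : ∀ z u → Acc _<_ u → z < u → Σ Elt λ c → _⋖_ B z c × c ≤ u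
    cover-below z u (acc below) z<u with any? (λ v → z <? v ×-dec v <? u)
    ... | yes (v , z<v , v<u) =
      let c , z⋖c , c≤v = cover-below z v (below v<u) z<v in c , z⋖c , ≤.trans c≤v (proj₁ v<u)
    ... | no ∄v = u , (z<u , λ w z<w w<u → ∄v (w , z<w , w<u)) , ≤.refl

    ρ-monotone : ∀ {z w} → z ≤ w → ρ z ℕ.≤ ρ w
    ρ-monotone {z} {w} = go z (<-noetherian z)
      where
      go : ∀ z → Acc (flip _<_) z → z ≤ w → ρ z ℕ.≤ ρ w
      go z (acc above) z≤w with z ≟ w
      ... | yes refl = ℕP.≤-refl
      ... | no z≢w   =
        let c , z⋖c , c≤w = cover-below z w (<-wellFounded w) (z≤w , z≢w) in
        ℕP.≤-trans (ℕP.≤-trans (ℕP.n≤1+n (ρ z)) (ℕP.≤-reflexive (sym (ρ-rank z c z⋖c))))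
                   (go c (above (proj₁ z⋖c)) c≤w)

    ε-split : ∀ {z w z'} → z ≤ w → w ≤ z' → ε z z' ≡ ε z w * ε w z'
    ε-split {z} {w} {z'} z≤w w≤z' = trans (cong (sign B) (∸-split (ρ-monotone z≤w) (ρ-monotone w≤z')))
                                          (sign-+ (ρ w ∸ ρ z) (ρ z' ∸ ρ w))

    ε-refl : ∀ z → ε z z ≡ 1ℤ
    ε-refl z = cong (sign B) (ℕP.n∸n≡0 (ρ z))

    ˆ-cong : ∀ {p q} → p ≈ q → p ˆ ≈ q ˆ
    ˆ-cong p≈q z z' z≤z' k = cong (ε z z' *_) (p≈q z z' z≤z' k)

    ˆ-vanish : ∀ {p z z' k} → p z z' k ≡ 0ℤ → (p ˆ) z z' k ≡ 0ℤ
    ˆ-vanish {z = z} {z'} p≡0 = trans (cong (ε z z' *_) p≡0) (ℤP.*-zeroʳ (ε z z'))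

    ˆ-involutive : ∀ p → p ˆ ˆ ≈ p
    ˆ-involutive p z z' _ k = begin
      ε z z' * (ε z z' * p z z' k)   ≡⟨ ℤP.*-assoc (ε z z') (ε z z') (p z z' k) ⟨
      ε z z' * ε z z' * p z z' k     ≡⟨ cong (_* p z z' k) (sign-*-sign (ρ z' ∸ ρ z)) ⟩
      1ℤ * p z z' k                  ≡⟨ ℤP.*-identityˡ (p z z' k) ⟩
      p z z' k                       ∎
      where open ≡-Reasoning

    Unipotent-ˆ : ∀ {p} → Unipotent p → Unipotent (p ˆ)
    Unipotent-ˆ {p} p-unit z k = trans (cong₂ _*_ (ε-refl z) (p-unit z k)) (ℤP.*-identityˡ (oneₚ k))

    δˆ : δ ˆ ≈ δ
    δˆ z z' _ k with z ≟ z'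
    ... | yes refl = trans (cong (_* oneₚ k) (ε-refl z)) (ℤP.*-identityˡ (oneₚ k))
    ... | no _     = ℤP.*-zeroʳ (ε z z')

    ˆ-· : ∀ p q → (p · q) ˆ ≈ p ˆ · q ˆ
    ˆ-· p q z z' _ k = begin
      ε z z' * (p · q) z z' k
        ≡⟨ cong (ε z z' *_) (·-as-sum p q z z' k) ⟩
      ε z z' * (∑[ w < size ] 𝟙 (between? z w z') ((p z w *ₚ q w z') k))
        ≡⟨ *-distribˡ-sum {size} (ε z z') _ ⟩
      ∑[ w < size ] (ε z z' * 𝟙 (between? z w z') ((p z w *ₚ q w z') k))
        ≡⟨ sum-cong-≗ {size} (λ w → trans (𝟙-*ˡ (between? z w z') (ε z z'))
             (𝟙-cong (between? z w z') λ (z≤w , w≤z') → begin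
               ε z z' * (p z w *ₚ q w z') k         ≡⟨ cong (_* (p z w *ₚ q w z') k) (ε-split z≤w w≤z') ⟩
               ε z w * ε w z' * (p z w *ₚ q w z') k ≡⟨ *ₚ-scale (p z w) (q w z') (ε z w) (ε w z') k ⟨
               ((p ˆ) z w *ₚ (q ˆ) w z') k          ∎)) ⟩
      ∑[ w < size ] 𝟙 (between? z w z') (((p ˆ) z w *ₚ (q ˆ) w z') k)
        ≡⟨ ·-as-sum (p ˆ) (q ˆ) z z' k ⟨
      (p ˆ · q ˆ) z z' k
        ∎
      where open ≡-Reasoning

    ˆ-≈δ : ∀ {p q} → p · q ≈ δ → p ˆ · q ˆ ≈ δ
    ˆ-≈δ {p} {q} pq≈δ = ≈-trans (≈-sym (ˆ-· p q)) (≈-trans (ˆ-cong pq≈δ) δˆ)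

    ·ˆ≈δ⇒ˆ·≈δ : ∀ {p q} → p · q ˆ ≈ δ → p ˆ · q ≈ δ
    ·ˆ≈δ⇒ˆ·≈δ {p} {q} pqˆ≈δ = ≈-trans (·-cong ≈-refl (≈-sym (ˆ-involutive q))) (ˆ-≈δ pqˆ≈δ)

    ˆ·≈δ⇒·ˆ≈δ : ∀ {p q} → p ˆ · q ≈ δ → p · q ˆ ≈ δ
    ˆ·≈δ⇒·ˆ≈δ {p} {q} pˆq≈δ = ≈-trans (·-cong (≈-sym (ˆ-involutive p)) ≈-refl) (ˆ-≈δ pˆq≈δ)

    rev-ˆ : ∀ r p → rev B r (p ˆ) ≈ rev B r p ˆ
    rev-ˆ r p z z' _ k = begin
      rev B r (p ˆ) z z' k                            ≡⟨ rev-as-revₚ r (p ˆ) z z' k ⟩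
      𝟙 (k ℕ.≤? r z z') (ε z z' * p z z' (r z z' ∸ k)) ≡⟨ 𝟙-*ˡ (k ℕ.≤? r z z') (ε z z') ⟨
      ε z z' * revₚ (r z z') (p z z') k                ≡⟨ cong (ε z z' *_) (rev-as-revₚ r p z z' k) ⟨
      (rev B r p ˆ) z z' k                            ∎
      where open ≡-Reasoning

  module Duality (r : Elt → Elt → ℕ) (r-weak : IsWeakRank B r) (ρ : Elt → ℕ) (ρ-rank : IsRank B ρ) where
    open WeakRank r r-weak
    open Ranked ρ ρ-rank

    InCalI-ˆ : ∀ {p} → InCalI B r p → InCalI B r (p ˆ)
    InCalI-ˆ {p} p-deg z z' z≤z' k r<k = ˆ-vanish {p} (p-deg z z' z≤z' k r<k)

    HalfVanishing-ˆ : ∀ {p} → HalfVanishing p → HalfVanishing (p ˆ)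
    HalfVanishing-ˆ {p} p-half z w z≤w i r≤2i 0<r+i = ˆ-vanish {p} (p-half z w z≤w i r≤2i 0<r+i)

    rev[g·fˆ]≈g·fˆ : ∀ {κ f g} → κ · rev B r κ ≈ δ → IsRankAlternating B r ρ κ →
                     InCalI B r f → rev B r f ≈ κ · f → InCalI B r g → rev B r g ≈ g · κ →
                     rev B r (g · f ˆ) ≈ g · f ˆ
    rev[g·fˆ]≈g·fˆ {κ} {f} {g} κκʳ≈δ κ-alt f-deg f-rev g-deg g-rev = begin
      rev B r (g · f ˆ)                 ≈⟨ rev-· g (f ˆ) g-deg (InCalI-ˆ f-deg) ⟩
      rev B r g · rev B r (f ˆ)         ≈⟨ ·-cong g-rev (≈-trans (rev-ˆ r f) (ˆ-cong f-rev)) ⟩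
      (g · κ) · (κ · f) ˆ               ≈⟨ ·-cong ≈-refl (ˆ-· κ f) ⟩
      (g · κ) · (κ ˆ · f ˆ)             ≈⟨ ·-cong ≈-refl (·-cong (≈-sym κ-alt) ≈-refl) ⟩
      (g · κ) · (rev B r κ · f ˆ)       ≈⟨ ·-assoc g κ (rev B r κ · f ˆ) ⟩
      g · (κ · (rev B r κ · f ˆ))       ≈⟨ ·-cong ≈-refl (≈-sym (·-assoc κ (rev B r κ) (f ˆ))) ⟩
      g · ((κ · rev B r κ) · f ˆ)       ≈⟨ ·-cong ≈-refl (·-cong κκʳ≈δ ≈-refl) ⟩
      g · (δ · f ˆ)                     ≈⟨ ·-cong ≈-refl (δ-· (f ˆ)) ⟩
      g · f ˆ                           ∎
      where open SetoidReasoning ≈-setoid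

lemma2p14 : (B : FinPoset) (ρ : FinPoset.Elt B → ℕ) →
    IsLowerEulerian B ρ →
    (r : FinPoset.Elt B → FinPoset.Elt B → ℕ) → IsWeakRank B r →
    (κ f g : Inc B) →
    IsKernel B r κ → IsRankAlternating B r ρ κ →
    IsRightKLS B r κ f → IsLeftKLS B r κ g →
    IsInverse B (hat B ρ f) g × IsInverse B (hat B ρ g) f
lemma2p14 B ρ (_ , ρ-rank , _) r r-weak κ f g (_ , _ , κκʳ≈δ , _) κ-alt
          (f-half , f-unit , f-rev) (g-half , g-unit , g-rev) =
  (fˆ·g≈δ , g·fˆ≈δ) , (·ˆ≈δ⇒ˆ·≈δ g·fˆ≈δ , ˆ·≈δ⇒·ˆ≈δ fˆ·g≈δ)
  where
  open Incidence B
  open WeakRank r r-weak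
  open Ranked ρ ρ-rank
  open Duality r r-weak ρ ρ-rank

  g·fˆ≈δ : g · f ˆ ≈ δ
  g·fˆ≈δ = self-dual⇒δ (g · f ˆ)
    (Unipotent-· g-unit (Unipotent-ˆ {f} f-unit))
    (HalfVanishing-· (InCalIHalf⇒HalfVanishing g-half g-unit)
                     (HalfVanishing-ˆ (InCalIHalf⇒HalfVanishing f-half f-unit)))
    (rev[g·fˆ]≈g·fˆ κκʳ≈δ κ-alt (proj₁ f-half) f-rev (proj₁ g-half) g-rev)

  fˆ·g≈δ : f ˆ · g ≈ δ
  fˆ·g≈δ = ·-inverse-flip g·fˆ≈δ (Unipotent-· (Unipotent-ˆ {f} f-unit) g-unit)
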